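{- Let $p$ be a prime and let $\sigma_1,\sigma_2,\dots$ be an ultimately periodic sequence of elements of $\mathbb F_p$. Then the series $U(x,\sigma_1,\sigma_2,\dots)\in\mathbb F_p[[x]]$ (with integer coefficients $t_{i,j}(n)$ reduced modulo $p$) is rational.
   Context: Integers $t_{i,j}(n)$ for $n\ge1$, $i,j\in\mathbb Z$: $t_{2,0}(1)=1$ and $t_{i,j}(1)=0$ otherwise; for $n\ge2$, $t_{i,j}(n)=(i-2)t_{i-1,j}(n-1)+t_{i-1,j-1}(n-1)+(i-3)t_{i-2,j}(n-1)$ (nonzero only for $n+1\le i\le 2n$, $0\le j\le 2n-i$). $U(x,\sigma_1,\sigma_2,\dots)=1-\sum_{n\ge1}x^n\sum_{i=n+1}^{2n}\sigma_i\sum_{j=0}^{2n-i}t_{i,j}(n)(-\sigma_1)^j$. -}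

module Defs where

open import Data.Nat as ℕ using (ℕ; zero; suc; _∸_)
open import Data.Integer using (ℤ; +_; _+_; _*_; _-_; -_; _^_)
open import Data.Integer.Properties using (_≟_)
open import Data.Integer.Divisibility using (_∣_)
open import Data.List using (List; []; _∷_)
open import Data.Product using (Σ; ∃; _×_)
open import Relation.Nullary using (¬_; yes; no)

sumBelow : ℕ → (ℕ → ℤ) → ℤ
sumBelow zero    f = + 0
sumBelow (suc n) f = sumBelow n f + f n

-- Σ_{i = a}^{b} f i  (empty if b < a)
sumFromTo : ℕ → ℕ → (ℕ → ℤ) → ℤ
sumFromTo a b f = sumBelow (suc b ∸ a) (λ k → f (a ℕ.+ k))

-- T k i j = t_{i,j}(k+1)
T : ℕ → ℤ → ℤ → ℤ
T zero i j with i ≟ + 2 | j ≟ + 0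
... | yes _ | yes _ = + 1
... | _     | _     = + 0
T (suc k) i j =
  (i - + 2) * T k (i - + 1) j + T k (i - + 1) (j - + 1) + (i - + 3) * T k (i - + 2) j

-- t_{i,j}(n) for n ≥ 1 (value at n = 0 is irrelevant and set to 0)
t : ℤ → ℤ → ℕ → ℤ
t i j zero    = + 0
t i j (suc k) = T k i j

-- coefficient of x^n in U(x, σ₁, σ₂, …); σ i stands for σ_i (σ 0 unused)
Ucoeff : (ℕ → ℤ) → ℕ → ℤ
Ucoeff σ zero = + 1
Ucoeff σ (suc m) =
  - sumFromTo (suc n) (n ℕ.+ n) (λ i →
      σ i * sumFromTo 0 ((n ℕ.+ n) ∸ i) (λ j →
        t (+ i) (+ j) n * ((- σ 1) ^ j)))
  where n = suc m

_≡_[mod_] : ℤ → ℤ → ℕ → Set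
a ≡ b [mod p ] = (+ p) ∣ (a - b)

UltPeriodicMod : ℕ → (ℕ → ℤ) → Set
UltPeriodicMod p σ =
  Σ ℕ λ N → Σ ℕ λ P → (P ℕ.> 0) × (∀ i → N ℕ.≤ i → σ (i ℕ.+ P) ≡ σ i [mod p ])

-- coefficients of a polynomial given as a list (low degree first)
coeff : List ℤ → ℕ → ℤ
coeff []       n       = + 0
coeff (a ∷ as) zero    = a
coeff (a ∷ as) (suc n) = coeff as n

mulCoeff : List ℤ → (ℕ → ℤ) → ℕ → ℤ
mulCoeff Q f n = sumFromTo 0 n (λ k → coeff Q k * f (n ∸ k))

IsRationalModP : ℕ → (ℕ → ℤ) → Set
IsRationalModP p f =
  Σ (List ℤ) λ P → Σ (List ℤ) λ Q →
    (∃ λ k → ¬ ((+ p) ∣ coeff Q k)) ×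
    (∀ n → mulCoeff Q f n ≡ coeff P n [mod p ])

-- Put s = -σ₁ and R k i = Σⱼ t_{i,j}(k+1) sʲ.  The recursion for t gives
-- R (k+1) (i+2) = (i+s) R k (i+1) + (i-1) R k i, so transposing it, the coefficient
-- of x^{k+1} in U is -(Φᵏ σ)(2) for the linear operator
-- (Φ g)(i) = (i-1+s) g(i+1) + (i-1) g(i+2); it only involves σᵢ for i ≥ k+2.
-- Modulo p the coefficients of Φ are p-periodic in i, so Φ maps sequences of period pP
-- to sequences of period pP, of which there are finitely many mod p.  Hence the orbit
-- of the periodic tail of σ under Φ is eventually periodic, so are the coefficients of
-- U, and an eventually periodic series is a polynomial divided by 1 - xᵀ.

module Submission where

open import Defs
open import Data.Empty using (⊥-elim)
open import Data.Fin using (Fin; toℕ; fromℕ<; funToFin; finToFun)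
import Data.Fin.Properties as FP
open import Data.Integer as ℤ using (ℤ; +_; -[1+_]; _+_; _*_; _-_; -_; _^_; +<+)
open import Data.Integer.DivMod using (_%ℕ_; _/ℕ_; n%ℕd<d; a≡a%ℕn+[a/ℕn]*n)
import Data.Integer.Divisibility.Signed as S
import Data.Integer.Properties as ℤP
open import Data.Integer.Tactic.RingSolver using (solve-∀)
open import Data.List using (List; []; _∷_; _++_; replicate; applyUpTo)
open import Data.Nat as ℕ using (ℕ; zero; suc; _∸_; z≤n; s≤s; NonZero)
open import Data.Nat.DivMod using (_%_; _/_; m≡m%n+[m/n]*n; m%n<n)
import Data.Nat.Divisibility as ND
open import Data.Nat.GeneralisedArithmetic using (iterate)
open import Data.Nat.Primality using (Prime; prime⇒nonZero; prime⇒nonTrivial)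
import Data.Nat.Properties as ℕP
open import Data.Product using (Σ; _×_; _,_)
open import Data.Sum using (inj₁; inj₂)
open import Function using (_∘_)
open import Relation.Binary.Bundles using (Setoid)
open import Relation.Binary.PropositionalEquality
open import Relation.Nullary using (yes; no)

sumBelow-cong : ∀ n {f g : ℕ → ℤ} → (∀ k → k ℕ.< n → f k ≡ g k) →
  sumBelow n f ≡ sumBelow n g
sumBelow-cong zero    f≡g = refl
sumBelow-cong (suc n) f≡g =
  cong₂ _+_ (sumBelow-cong n (λ k k<n → f≡g k (ℕP.m<n⇒m<1+n k<n))) (f≡g n ℕP.≤-refl)

sumBelow-zero : ∀ n {f : ℕ → ℤ} → (∀ k → k ℕ.< n → f k ≡ + 0) → sumBelow n f ≡ + 0
sumBelow-zero zero    f≡0 = refl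
sumBelow-zero (suc n) f≡0 =
  cong₂ _+_ (sumBelow-zero n (λ k k<n → f≡0 k (ℕP.m<n⇒m<1+n k<n))) (f≡0 n ℕP.≤-refl)

sumBelow-+ : ∀ n (f g : ℕ → ℤ) → sumBelow n (λ k → f k + g k) ≡ sumBelow n f + sumBelow n g
sumBelow-+ zero    f g = refl
sumBelow-+ (suc n) f g =
  trans (cong (_+ (f n + g n)) (sumBelow-+ n f g)) (interchange (sumBelow n f) (sumBelow n g) (f n) (g n))
  where
  interchange : ∀ a b c d → (a + b) + (c + d) ≡ (a + c) + (b + d)
  interchange = solve-∀

sumBelow-*ˡ : ∀ n c (f : ℕ → ℤ) → sumBelow n (λ k → c * f k) ≡ c * sumBelow n f
sumBelow-*ˡ zero    c f = sym (ℤP.*-zeroʳ c)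
sumBelow-*ˡ (suc n) c f =
  trans (cong (_+ c * f n) (sumBelow-*ˡ n c f)) (sym (ℤP.*-distribˡ-+ c _ _))

sumBelow-linear₃ : ∀ n a b (x y z : ℕ → ℤ) →
  sumBelow n (λ j → a * x j + y j + b * z j) ≡ a * sumBelow n x + sumBelow n y + b * sumBelow n z
sumBelow-linear₃ n a b x y z = begin
  sumBelow n (λ j → a * x j + y j + b * z j)
    ≡⟨ sumBelow-+ n _ _ ⟩
  sumBelow n (λ j → a * x j + y j) + sumBelow n (λ j → b * z j)
    ≡⟨ cong₂ _+_ (sumBelow-+ n _ _) (sumBelow-*ˡ n b z) ⟩
  sumBelow n (λ j → a * x j) + sumBelow n y + b * sumBelow n z
    ≡⟨ cong (λ u → u + sumBelow n y + b * sumBelow n z) (sumBelow-*ˡ n a x) ⟩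
  a * sumBelow n x + sumBelow n y + b * sumBelow n z ∎
  where open ≡-Reasoning

sumBelow-suc-head : ∀ n (f : ℕ → ℤ) → sumBelow (suc n) f ≡ f 0 + sumBelow n (f ∘ suc)
sumBelow-suc-head zero    f = trans (ℤP.+-identityˡ (f 0)) (sym (ℤP.+-identityʳ (f 0)))
sumBelow-suc-head (suc n) f =
  trans (cong (_+ f (suc n)) (sumBelow-suc-head n f)) (ℤP.+-assoc (f 0) _ _)

sumBelow-+-split : ∀ a b (f : ℕ → ℤ) →
  sumBelow (a ℕ.+ b) f ≡ sumBelow a f + sumBelow b (λ k → f (a ℕ.+ k))
sumBelow-+-split a zero    f =
  trans (cong (λ n → sumBelow n f) (ℕP.+-identityʳ a)) (sym (ℤP.+-identityʳ _))
sumBelow-+-split a (suc b) f = begin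
  sumBelow (a ℕ.+ suc b) f
    ≡⟨ cong (λ n → sumBelow n f) (ℕP.+-suc a b) ⟩
  sumBelow (a ℕ.+ b) f + f (a ℕ.+ b)
    ≡⟨ cong (_+ f (a ℕ.+ b)) (sumBelow-+-split a b f) ⟩
  sumBelow a f + sumBelow b (λ k → f (a ℕ.+ k)) + f (a ℕ.+ b)
    ≡⟨ ℤP.+-assoc (sumBelow a f) _ _ ⟩
  sumBelow a f + sumBelow (suc b) (λ k → f (a ℕ.+ k)) ∎
  where open ≡-Reasoning

sumBelow-+-split-zeroˡ : ∀ a b {f : ℕ → ℤ} → (∀ k → k ℕ.< a → f k ≡ + 0) →
  sumBelow (a ℕ.+ b) f ≡ sumBelow b (λ k → f (a ℕ.+ k))
sumBelow-+-split-zeroˡ a b {f} f≡0 =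
  trans (sumBelow-+-split a b f)
        (trans (cong (_+ sumBelow b (λ k → f (a ℕ.+ k))) (sumBelow-zero a f≡0)) (ℤP.+-identityˡ _))

sumBelow-pad : ∀ {a b} {f : ℕ → ℤ} → a ℕ.≤ b → (∀ k → a ℕ.≤ k → f k ≡ + 0) →
  sumBelow b f ≡ sumBelow a f
sumBelow-pad {a} {b} {f} a≤b f≡0 = begin
  sumBelow b f
    ≡⟨ cong (λ n → sumBelow n f) (sym (ℕP.m+[n∸m]≡n a≤b)) ⟩
  sumBelow (a ℕ.+ (b ∸ a)) f
    ≡⟨ sumBelow-+-split a (b ∸ a) f ⟩
  sumBelow a f + sumBelow (b ∸ a) (λ k → f (a ℕ.+ k))
    ≡⟨ cong (λ x → sumBelow a f + x) (sumBelow-zero (b ∸ a) (λ k _ → f≡0 (a ℕ.+ k) (ℕP.m≤m+n a k))) ⟩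
  sumBelow a f + + 0
    ≡⟨ ℤP.+-identityʳ _ ⟩
  sumBelow a f ∎
  where open ≡-Reasoning

sumBelow-stable : ∀ {a b} {f : ℕ → ℤ} →
  (∀ k → a ℕ.≤ k → f k ≡ + 0) → (∀ k → b ℕ.≤ k → f k ≡ + 0) → sumBelow a f ≡ sumBelow b f
sumBelow-stable {a} {b} fa fb with ℕP.≤-total a b
... | inj₁ a≤b = sym (sumBelow-pad a≤b fa)
... | inj₂ b≤a = sumBelow-pad b≤a fb

sumBelow-drop-head : ∀ n {f : ℕ → ℤ} → f 0 ≡ + 0 → sumBelow (suc n) f ≡ sumBelow n (f ∘ suc)
sumBelow-drop-head n f0≡0 = sumBelow-+-split-zeroˡ 1 n (λ { zero _ → f0≡0 ; (suc _) (s≤s ()) })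

sumBelow-shift : ∀ n {f : ℕ → ℤ} → f 0 ≡ + 0 → f n ≡ + 0 → sumBelow n (f ∘ suc) ≡ sumBelow n f
sumBelow-shift n {f} f0≡0 fn≡0 = begin
  sumBelow n (f ∘ suc)    ≡⟨ sym (sumBelow-drop-head n {f} f0≡0) ⟩
  sumBelow n f + f n      ≡⟨ cong (λ x → sumBelow n f + x) fn≡0 ⟩
  sumBelow n f + + 0      ≡⟨ ℤP.+-identityʳ _ ⟩
  sumBelow n f            ∎
  where open ≡-Reasoning

sumFromTo≡sumBelow : ∀ {a} b {f : ℕ → ℤ} → a ℕ.≤ suc b → (∀ k → k ℕ.< a → f k ≡ + 0) →
  sumFromTo a b f ≡ sumBelow (suc b) f
sumFromTo≡sumBelow {a} b {f} a≤1+b f≡0 =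
  trans (sym (sumBelow-+-split-zeroˡ a (suc b ∸ a) f≡0)) (cong (λ n → sumBelow n f) (ℕP.m+[n∸m]≡n a≤1+b))

-- 2n for n = k + 1, written like the upper limit n + n of Ucoeff so that the inner sum of
-- Ucoeff is R below by definition.
diag : ℕ → ℕ
diag k = suc k ℕ.+ suc k

diag-suc : ∀ k → diag (suc k) ≡ suc (suc (diag k))
diag-suc k = cong suc (ℕP.+-suc (suc k) (suc k))

T-suc≡0 : ∀ k i j →
  T k (i - + 1) j ≡ + 0 → T k (i - + 1) (j - + 1) ≡ + 0 → T k (i - + 2) j ≡ + 0 → T (suc k) i j ≡ + 0
T-suc≡0 k i j a≡0 b≡0 c≡0
  rewrite a≡0 | b≡0 | c≡0 | ℤP.*-zeroʳ (i - + 2) | ℤP.*-zeroʳ (i - + 3) = refl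

T-negative-j : ∀ k i n → T k i -[1+ n ] ≡ + 0
T-negative-j zero    i n with i ℤP.≟ + 2 | -[1+ n ] ℤP.≟ + 0
... | yes _ | no _ = refl
... | no _  | no _ = refl
T-negative-j (suc k) i n = T-suc≡0 k i -[1+ n ]
  (T-negative-j k (i - + 1) n)
  -- -[1+ n ] - + 1 normalises to -[1+ suc (n + 0) ]
  (subst (λ j → T k (i - + 1) j ≡ + 0) (cong (λ m → -[1+ suc m ]) (sym (ℕP.+-identityʳ n)))
         (T-negative-j k (i - + 1) (suc n)))
  (T-negative-j k (i - + 2) n)

T-small-i : ∀ k i j → i ℤ.< + suc (suc k) → T k i j ≡ + 0
T-small-i zero    i j i<2 with i ℤP.≟ + 2 | j ℤP.≟ + 0
... | no _     | _     = refl
... | yes _    | no _  = refl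
... | yes refl | yes _ = ⊥-elim (ℤP.<-irrefl refl i<2)
T-small-i (suc k) i j i<k+3 = T-suc≡0 k i j
  (T-small-i k (i - + 1) j (ℤP.+-monoˡ-< (- + 1) i<k+3))
  (T-small-i k (i - + 1) (j - + 1) (ℤP.+-monoˡ-< (- + 1) i<k+3))
  (T-small-i k (i - + 2) j (ℤP.+-monoˡ-< (- + 2) (ℤP.<-trans i<k+3 (+<+ (ℕP.n<1+n _)))))

T-beyond-diag : ∀ k i j → + diag k ℤ.< i + j → T k i j ≡ + 0
T-beyond-diag zero    i j 2<i+j with i ℤP.≟ + 2 | j ℤP.≟ + 0
... | no _     | _        = refl
... | yes _    | no _     = refl
... | yes refl | yes refl = ⊥-elim (ℤP.<-irrefl refl 2<i+j)
T-beyond-diag (suc k) i j lt = T-suc≡0 k i j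
  (T-beyond-diag k (i - + 1) j (subst (+ diag k ℤ.<_) (shift₁ i j) (ℤP.<-trans (+<+ (ℕP.n<1+n _)) lt-1)))
  (T-beyond-diag k (i - + 1) (j - + 1) (subst (+ diag k ℤ.<_) (shift₂ i j) lt-2))
  (T-beyond-diag k (i - + 2) j (subst (+ diag k ℤ.<_) (shift₃ i j) lt-2))
  where
  lt′ : + suc (suc (diag k)) ℤ.< i + j
  lt′ = subst (λ d → + d ℤ.< i + j) (diag-suc k) lt
  lt-1 : + suc (diag k) ℤ.< i + j - + 1
  lt-1 = ℤP.+-monoˡ-< (- + 1) lt′
  lt-2 : + diag k ℤ.< i + j - + 2
  lt-2 = ℤP.+-monoˡ-< (- + 2) lt′
  shift₁ : ∀ i j → i + j - + 1 ≡ i - + 1 + j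
  shift₁ = solve-∀
  shift₂ : ∀ i j → i + j - + 2 ≡ i - + 1 + (j - + 1)
  shift₂ = solve-∀
  shift₃ : ∀ i j → i + j - + 2 ≡ i - + 2 + j
  shift₃ = solve-∀

T-beyond-row : ∀ k i j → diag k ∸ i ℕ.< j → T k (+ i) (+ j) ≡ + 0
T-beyond-row k i j lt =
  T-beyond-diag k (+ i) (+ j) (+<+ (ℕP.≤-<-trans (ℕP.m≤n+m∸n (diag k) i) (ℕP.+-monoʳ-< i lt)))

T-beyond-degree : ∀ k i j → k ℕ.< j → T k (+ i) (+ j) ≡ + 0
T-beyond-degree k i j k<j with i ℕ.<? suc (suc k)
... | yes i<k+2 = T-small-i k (+ i) (+ j) (+<+ i<k+2)
... | no  i≮k+2 = T-beyond-diag k (+ i) (+ j) (+<+ (ℕP.+-mono-≤ (ℕP.≮⇒≥ i≮k+2) k<j))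

Φ : ℤ → (ℕ → ℤ) → ℕ → ℤ
Φ s g i = (+ i - + 1 + s) * g (suc i) + (+ i - + 1) * g (suc (suc i))

module RowSums (s : ℤ) where

  rowTerm : ℕ → ℕ → ℕ → ℤ
  rowTerm k i j = T k (+ i) (+ j) * s ^ j

  rowSum : ℕ → ℕ → ℕ → ℤ
  rowSum k i B = sumBelow B (rowTerm k i)

  R : ℕ → ℕ → ℤ
  R k i = rowSum k i (suc (diag k ∸ i))

  rowTerm≡0 : ∀ k i j → T k (+ i) (+ j) ≡ + 0 → rowTerm k i j ≡ + 0
  rowTerm≡0 k i j T≡0 = trans (cong (_* s ^ j) T≡0) (ℤP.*-zeroˡ (s ^ j))

  R≡rowSum : ∀ k i {B} → k ℕ.< B → R k i ≡ rowSum k i B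
  R≡rowSum k i k<B = sumBelow-stable {f = rowTerm k i}
    (λ j lt → rowTerm≡0 k i j (T-beyond-row k i j lt))
    (λ j lt → rowTerm≡0 k i j (T-beyond-degree k i j (ℕP.<-≤-trans k<B lt)))

  R-small : ∀ k i → i ℕ.< suc (suc k) → R k i ≡ + 0
  R-small k i i<k+2 = sumBelow-zero (suc (diag k ∸ i)) {rowTerm k i} (λ j _ →
    rowTerm≡0 k i j (T-small-i k (+ i) (+ j) (+<+ i<k+2)))

  R-large : ∀ k i → diag k ℕ.< i → R k i ≡ + 0
  R-large k i diag<i = sumBelow-zero (suc (diag k ∸ i)) {rowTerm k i} (λ j _ →
    rowTerm≡0 k i j (T-beyond-diag k (+ i) (+ j) (+<+ (ℕP.≤-trans diag<i (ℕP.m≤m+n i j)))))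

  rowSum-shifted : ∀ k i → sumBelow (suc (suc k)) (λ j → T k (+ i) (+ j - + 1) * s ^ j) ≡ s * R k i
  rowSum-shifted k i = begin
    sumBelow (suc (suc k)) (λ j → T k (+ i) (+ j - + 1) * s ^ j)
      ≡⟨ sumBelow-drop-head (suc k) (cong (_* + 1) (T-negative-j k (+ i) 0)) ⟩
    sumBelow (suc k) (λ j → T k (+ i) (+ j) * (s * s ^ j))
      ≡⟨ sumBelow-cong (suc k) (λ j _ → swap (T k (+ i) (+ j)) s (s ^ j)) ⟩
    sumBelow (suc k) (λ j → s * rowTerm k i j)
      ≡⟨ sumBelow-*ˡ (suc k) s (rowTerm k i) ⟩
    s * rowSum k i (suc k)
      ≡⟨ cong (s *_) (sym (R≡rowSum k i ℕP.≤-refl)) ⟩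
    s * R k i ∎
    where
    open ≡-Reasoning
    swap : ∀ a s w → a * (s * w) ≡ s * (a * w)
    swap = solve-∀

  R-rec : ∀ k i → R (suc k) (suc (suc i)) ≡ (+ i + s) * R k (suc i) + (+ i - + 1) * R k i
  R-rec k i = begin
    R (suc k) (suc (suc i))
      ≡⟨ R≡rowSum (suc k) (suc (suc i)) ℕP.≤-refl ⟩
    sumBelow (k+2) (λ j → (+ i * A j + B j + (+ suc (suc i) - + 3) * C j) * s ^ j)
      ≡⟨ sumBelow-cong (k+2) (λ j _ → expand (A j) (B j) (C j) (s ^ j)) ⟩
    sumBelow (k+2) (λ j → + i * (A j * s ^ j) + B j * s ^ j + (+ i - + 1) * (C j * s ^ j))
      ≡⟨ sumBelow-linear₃ (k+2) (+ i) (+ i - + 1) _ _ _ ⟩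
    + i * rowSum k (suc i) (k+2) + sumBelow (k+2) (λ j → B j * s ^ j) + (+ i - + 1) * rowSum k i (k+2)
      ≡⟨ cong₂ (λ a c → + i * a + sumBelow (k+2) (λ j → B j * s ^ j) + (+ i - + 1) * c)
               (sym (R≡rowSum k (suc i) (ℕP.n≤1+n (suc k)))) (sym (R≡rowSum k i (ℕP.n≤1+n (suc k)))) ⟩
    + i * R k (suc i) + sumBelow (k+2) (λ j → B j * s ^ j) + (+ i - + 1) * R k i
      ≡⟨ cong (λ b → + i * R k (suc i) + b + (+ i - + 1) * R k i) (rowSum-shifted k (suc i)) ⟩
    + i * R k (suc i) + s * R k (suc i) + (+ i - + 1) * R k i
      ≡⟨ cong (_+ (+ i - + 1) * R k i) (sym (ℤP.*-distribʳ-+ (R k (suc i)) (+ i) s)) ⟩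
    (+ i + s) * R k (suc i) + (+ i - + 1) * R k i ∎
    where
    open ≡-Reasoning
    k+2 = suc (suc k)
    A B C : ℕ → ℤ
    A j = T k (+ suc i) (+ j)
    B j = T k (+ suc i) (+ j - + 1)
    C j = T k (+ i) (+ j)
    -- _⊖_ computes by comparison, so this needs a case split on i.
    2+i-3 : ∀ i → + suc (suc i) - + 3 ≡ + i - + 1
    2+i-3 zero    = refl
    2+i-3 (suc i) = refl
    distrib : ∀ x a b c w → (x * a + b + (x - + 1) * c) * w ≡ x * (a * w) + b * w + (x - + 1) * (c * w)
    distrib = solve-∀
    expand : ∀ a b c w →
      (+ i * a + b + (+ suc (suc i) - + 3) * c) * w ≡ + i * (a * w) + b * w + (+ i - + 1) * (c * w)
    expand a b c w rewrite 2+i-3 i = distrib (+ i) a b c w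

  pairing : ℕ → (ℕ → ℤ) → ℕ → ℤ
  pairing k g B = sumBelow B (λ i → g i * R k i)

  pairing-suc : ∀ k g B → diag k ℕ.< B → pairing (suc k) g (suc (suc B)) ≡ pairing k (Φ s g) B
  pairing-suc k g B diag<B = begin
    pairing (suc k) g (suc (suc B))
      ≡⟨ sumBelow-drop-head (suc B) (g*R≡0 (suc k) 0 (s≤s z≤n)) ⟩
    sumBelow (suc B) (λ i → g (suc i) * R (suc k) (suc i))
      ≡⟨ sumBelow-drop-head B (g*R≡0 (suc k) 1 (s≤s (s≤s z≤n))) ⟩
    sumBelow B (λ i → g (suc (suc i)) * R (suc k) (suc (suc i)))
      ≡⟨ sumBelow-cong B (λ i _ → trans (cong (g (suc (suc i)) *_) (R-rec k i))
                                         (expand (+ i) s (g (suc (suc i))) (R k (suc i)) (R k i))) ⟩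
    sumBelow B (λ i → a (suc i) + b i)
      ≡⟨ sumBelow-+ B (a ∘ suc) b ⟩
    sumBelow B (a ∘ suc) + sumBelow B b
      ≡⟨ cong (_+ sumBelow B b) (sumBelow-shift B a0≡0 aB≡0) ⟩
    sumBelow B a + sumBelow B b
      ≡⟨ sym (sumBelow-+ B a b) ⟩
    sumBelow B (λ i → a i + b i)
      ≡⟨ sumBelow-cong B (λ i _ → sym (ℤP.*-distribʳ-+ (R k i) (Φ₁ i) (Φ₂ i))) ⟩
    pairing k (Φ s g) B ∎
    where
    open ≡-Reasoning
    Φ₁ Φ₂ a b : ℕ → ℤ
    Φ₁ i = (+ i - + 1 + s) * g (suc i)
    Φ₂ i = (+ i - + 1) * g (suc (suc i))
    a i = Φ₁ i * R k i
    b i = Φ₂ i * R k i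
    g*R≡0 : ∀ k i → i ℕ.< suc (suc k) → g i * R k i ≡ + 0
    g*R≡0 k i i<k+2 = trans (cong (g i *_) (R-small k i i<k+2)) (ℤP.*-zeroʳ (g i))
    a0≡0 : a 0 ≡ + 0
    a0≡0 = trans (cong (Φ₁ 0 *_) (R-small k 0 (s≤s z≤n))) (ℤP.*-zeroʳ (Φ₁ 0))
    aB≡0 : a B ≡ + 0
    aB≡0 = trans (cong (Φ₁ B *_) (R-large k B diag<B)) (ℤP.*-zeroʳ (Φ₁ B))
    expand : ∀ x s h r₁ r₀ → h * ((x + s) * r₁ + (x - + 1) * r₀) ≡ (x + s) * h * r₁ + (x - + 1) * h * r₀
    expand = solve-∀

  pairing≡iterate : ∀ k g B → diag k ℕ.< B → pairing k g B ≡ iterate (Φ s) g k 2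
  pairing≡iterate zero g B 2<B = begin
    pairing zero g B
      ≡⟨ sumBelow-pad 2<B (λ i 3≤i → trans (cong (g i *_) (R-large 0 i 3≤i)) (ℤP.*-zeroʳ (g i))) ⟩
    pairing zero g 3
      ≡⟨ evaluate (g 0) (g 1) (g 2) ⟩
    g 2 ∎
    where
    open ≡-Reasoning
    evaluate : ∀ a b c → + 0 + a * + 0 + b * + 0 + c * + 1 ≡ c
    evaluate = solve-∀
  pairing≡iterate (suc k) g (suc zero)      (s≤s ())
  pairing≡iterate (suc k) g (suc (suc B)) lt =
    trans (pairing-suc k g B diag<B) (pairing≡iterate k (Φ s g) B diag<B)
    where
    diag<B : diag k ℕ.< B
    diag<B = ℕP.≤-pred (ℕP.≤-pred (subst (ℕ._< suc (suc B)) (diag-suc k) lt))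

Ucoeff-suc : ∀ σ m → Ucoeff σ (suc m) ≡ - iterate (Φ (- σ 1)) σ m 2
Ucoeff-suc σ m = cong -_ (begin
  sumFromTo (suc (suc m)) (diag m) (λ i → σ i * R m i)
    ≡⟨ sumFromTo≡sumBelow (diag m) (s≤s (ℕP.m≤m+n (suc m) (suc m)))
         (λ i i<m+2 → trans (cong (σ i *_) (R-small m i i<m+2)) (ℤP.*-zeroʳ (σ i))) ⟩
  pairing m σ (suc (diag m))
    ≡⟨ pairing≡iterate m σ (suc (diag m)) ℕP.≤-refl ⟩
  iterate (Φ (- σ 1)) σ m 2 ∎)
  where
  open ≡-Reasoning
  open RowSums (- σ 1)

iterate-+ : ∀ {A : Set} (f : A → A) x a b → iterate f x (a ℕ.+ b) ≡ iterate f (iterate f x a) b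
iterate-+ f x zero    b = refl
iterate-+ f x (suc a) b = iterate-+ f (f x) a b

iterate-preserves : ∀ {A : Set} {P : A → Set} (f : A → A) → (∀ {x} → P x → P (f x)) →
  ∀ {x} k → P x → P (iterate f x k)
iterate-preserves         f f-pres     zero    Px = Px
iterate-preserves {P = P} f f-pres {x} (suc k) Px = iterate-preserves {P = P} f f-pres {f x} k (f-pres Px)

iterate-cong : ∀ {A : Set} {_~_ : A → A → Set} (f : A → A) → (∀ {x y} → x ~ y → f x ~ f y) →
  ∀ {x y} k → x ~ y → iterate f x k ~ iterate f y k
iterate-cong              f f-cong         zero    x~y = x~y
iterate-cong {_~_ = _~_} f f-cong {x} {y} (suc k) x~y =
  iterate-cong {_~_ = _~_} f f-cong {f x} {f y} k (f-cong x~y)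

iterate-eventually-periodic : ∀ {A : Set} {_~_ : A → A → Set} (f : A → A) →
  (∀ {x y} → x ~ y → f x ~ f y) →
  ∀ {x k₁ k₂} → k₁ ℕ.≤ k₂ → iterate f x k₂ ~ iterate f x k₁ →
  ∀ m → k₁ ℕ.≤ m → iterate f x (m ℕ.+ (k₂ ∸ k₁)) ~ iterate f x m
iterate-eventually-periodic {_~_ = _~_} f f-cong {x} {k₁} {k₂} k₁≤k₂ loop m k₁≤m =
  subst₂ _~_ (trans (sym (iterate-+ f x k₂ d)) (cong (iterate f x) k₂+d≡m+e))
             (trans (sym (iterate-+ f x k₁ d)) (cong (iterate f x) (ℕP.m+[n∸m]≡n k₁≤m)))
             (iterate-cong {_~_ = _~_} f f-cong d loop)
  where
  open ≡-Reasoning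
  d = m ∸ k₁
  e = k₂ ∸ k₁
  k₂+d≡m+e : k₂ ℕ.+ d ≡ m ℕ.+ e
  k₂+d≡m+e = begin
    k₂ ℕ.+ d          ≡⟨ cong (ℕ._+ d) (sym (ℕP.m+[n∸m]≡n k₁≤k₂)) ⟩
    k₁ ℕ.+ e ℕ.+ d    ≡⟨ ℕP.+-assoc k₁ e d ⟩
    k₁ ℕ.+ (e ℕ.+ d)  ≡⟨ cong (k₁ ℕ.+_) (ℕP.+-comm e d) ⟩
    k₁ ℕ.+ (d ℕ.+ e)  ≡⟨ sym (ℕP.+-assoc k₁ d e) ⟩
    k₁ ℕ.+ d ℕ.+ e    ≡⟨ cong (ℕ._+ e) (ℕP.m+[n∸m]≡n k₁≤m) ⟩
    m ℕ.+ e           ∎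

neg-x^ : ℕ → List ℤ
neg-x^ d = replicate d (+ 0) ++ - + 1 ∷ []

one-minus-x^suc : ℕ → List ℤ
one-minus-x^suc T = + 1 ∷ neg-x^ T

sumBelow-coeff-neg-x^ : ∀ d L (g : ℕ → ℤ) → d ℕ.< L →
  sumBelow L (λ k → coeff (neg-x^ d) k * g k) ≡ - g d
sumBelow-coeff-neg-x^ zero (suc L) g _ = begin
  sumBelow (suc L) (λ k → coeff (neg-x^ 0) k * g k)
    ≡⟨ sumBelow-suc-head L _ ⟩
  - + 1 * g 0 + sumBelow L (λ k → + 0 * g (suc k))
    ≡⟨ cong₂ _+_ (ℤP.-1*i≡-i (g 0)) (sumBelow-zero L (λ k _ → ℤP.*-zeroˡ (g (suc k)))) ⟩
  - g 0 + + 0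
    ≡⟨ ℤP.+-identityʳ (- g 0) ⟩
  - g 0 ∎
  where open ≡-Reasoning
sumBelow-coeff-neg-x^ (suc d) (suc L) g (s≤s d<L) = begin
  sumBelow (suc L) (λ k → coeff (neg-x^ (suc d)) k * g k)
    ≡⟨ sumBelow-suc-head L _ ⟩
  + 0 * g 0 + sumBelow L (λ k → coeff (neg-x^ d) k * g (suc k))
    ≡⟨ cong (λ x → + 0 * g 0 + x) (sumBelow-coeff-neg-x^ d L (g ∘ suc) d<L) ⟩
  + 0 * g 0 + - g (suc d)
    ≡⟨ ℤP.+-identityˡ (- g (suc d)) ⟩
  - g (suc d) ∎
  where open ≡-Reasoning

mulCoeff-one-minus-x^suc : ∀ T (f : ℕ → ℤ) n → T ℕ.< n →
  mulCoeff (one-minus-x^suc T) f n ≡ f n - f (n ∸ suc T)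
mulCoeff-one-minus-x^suc T f n T<n = begin
  mulCoeff (one-minus-x^suc T) f n
    ≡⟨ sumBelow-suc-head n _ ⟩
  + 1 * f n + sumBelow n (λ k → coeff (neg-x^ T) k * f (n ∸ suc k))
    ≡⟨ cong₂ _+_ (ℤP.*-identityˡ (f n)) (sumBelow-coeff-neg-x^ T n (λ k → f (n ∸ suc k)) T<n) ⟩
  f n - f (n ∸ suc T) ∎
  where open ≡-Reasoning

coeff-applyUpTo-< : ∀ (h : ℕ → ℤ) {L n} → n ℕ.< L → coeff (applyUpTo h L) n ≡ h n
coeff-applyUpTo-< h {suc L} {zero}  _         = refl
coeff-applyUpTo-< h {suc L} {suc n} (s≤s n<L) = coeff-applyUpTo-< (h ∘ suc) n<L

coeff-applyUpTo-≥ : ∀ (h : ℕ → ℤ) {L n} → L ℕ.≤ n → coeff (applyUpTo h L) n ≡ + 0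
coeff-applyUpTo-≥ h {zero}          _         = refl
coeff-applyUpTo-≥ h {suc L} {suc n} (s≤s L≤n) = coeff-applyUpTo-≥ (h ∘ suc) L≤n

module Modular (p : ℕ) where

  infix 4 _≈_ _≈ᶠ_

  record _≈_ (a b : ℤ) : Set where
    constructor mk≈
    field p∣a-b : + p S.∣ a - b

  open _≈_

  _≈ᶠ_ : (ℕ → ℤ) → (ℕ → ℤ) → Set
  g ≈ᶠ h = ∀ i → g i ≈ h i

  ≈⇒≡[mod] : ∀ {a b} → a ≈ b → a ≡ b [mod p ]
  ≈⇒≡[mod] a≈b = S.∣⇒∣ᵤ (p∣a-b a≈b)

  ≡[mod]⇒≈ : ∀ {a b} → a ≡ b [mod p ] → a ≈ b
  ≡[mod]⇒≈ a≡b = mk≈ (S.∣ᵤ⇒∣ a≡b)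

  ≈-reflexive : ∀ {a b} → a ≡ b → a ≈ b
  ≈-reflexive {a} refl = mk≈ (S.divides (+ 0) (ℤP.+-inverseʳ a))

  ≈-refl : ∀ {a} → a ≈ a
  ≈-refl = ≈-reflexive refl

  ≈-sym : ∀ {a b} → a ≈ b → b ≈ a
  ≈-sym {a} {b} (mk≈ h) = mk≈ (subst (+ p S.∣_) (lemma a b) (S.∣m⇒∣-m h))
    where
    lemma : ∀ a b → - (a - b) ≡ b - a
    lemma = solve-∀

  ≈-trans : ∀ {a b c} → a ≈ b → b ≈ c → a ≈ c
  ≈-trans {a} {b} {c} (mk≈ h₁) (mk≈ h₂) = mk≈ (subst (+ p S.∣_) (lemma a b c) (S.∣m∣n⇒∣m+n h₁ h₂))
    where
    lemma : ∀ a b c → (a - b) + (b - c) ≡ a - c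
    lemma = solve-∀

  ≈-setoid : Setoid _ _
  ≈-setoid = record
    { Carrier = ℤ ; _≈_ = _≈_
    ; isEquivalence = record { refl = ≈-refl ; sym = ≈-sym ; trans = ≈-trans } }

  +-cong : ∀ {a a′ b b′} → a ≈ a′ → b ≈ b′ → a + b ≈ a′ + b′
  +-cong {a} {a′} {b} {b′} (mk≈ h₁) (mk≈ h₂) =
    mk≈ (subst (+ p S.∣_) (lemma a a′ b b′) (S.∣m∣n⇒∣m+n h₁ h₂))
    where
    lemma : ∀ a a′ b b′ → (a - a′) + (b - b′) ≡ (a + b) - (a′ + b′)
    lemma = solve-∀

  *-cong : ∀ {a a′ b b′} → a ≈ a′ → b ≈ b′ → a * b ≈ a′ * b′
  *-cong {a} {a′} {b} {b′} (mk≈ h₁) (mk≈ h₂) =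
    mk≈ (subst (+ p S.∣_) (lemma a a′ b b′) (S.∣m∣n⇒∣m+n (S.∣m⇒∣m*n b h₁) (S.∣n⇒∣m*n a′ h₂)))
    where
    lemma : ∀ a a′ b b′ → (a - a′) * b + a′ * (b - b′) ≡ a * b - a′ * b′
    lemma = solve-∀

  *-congˡ : ∀ c {b b′} → b ≈ b′ → c * b ≈ c * b′
  *-congˡ c = *-cong (≈-refl {c})

  neg-cong : ∀ {a a′} → a ≈ a′ → - a ≈ - a′
  neg-cong {a} {a′} (mk≈ h) = mk≈ (subst (+ p S.∣_) (lemma a a′) (S.∣m⇒∣-m h))
    where
    lemma : ∀ a a′ → - (a - a′) ≡ - a - - a′
    lemma = solve-∀

  +-multiple : ∀ i q → + (i ℕ.+ p ℕ.* q) ≈ + i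
  +-multiple i q = mk≈ (S.divides (+ q) (begin
    + (i ℕ.+ p ℕ.* q) - + i    ≡⟨ cancel (+ i) (+ (p ℕ.* q)) ⟩
    + (p ℕ.* q)                ≡⟨ cong +_ (ℕP.*-comm p q) ⟩
    + (q ℕ.* p)                ≡⟨ ℤP.pos-* q p ⟩
    + q * + p                  ∎))
    where
    open ≡-Reasoning
    cancel : ∀ x y → x + y - x ≡ y
    cancel = solve-∀

  sumBelow-cong-≈ : ∀ n {f g : ℕ → ℤ} → (∀ k → k ℕ.< n → f k ≈ g k) → sumBelow n f ≈ sumBelow n g
  sumBelow-cong-≈ zero    f≈g = ≈-refl
  sumBelow-cong-≈ (suc n) f≈g =
    +-cong (sumBelow-cong-≈ n (λ k k<n → f≈g k (ℕP.m<n⇒m<1+n k<n))) (f≈g n ℕP.≤-refl)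

  Φ-cong : ∀ s {g h} → g ≈ᶠ h → Φ s g ≈ᶠ Φ s h
  Φ-cong s g≈h i =
    +-cong (*-congˡ (+ i - + 1 + s) (g≈h (suc i))) (*-congˡ (+ i - + 1) (g≈h (suc (suc i))))

  iterate-Φ-local : ∀ s m {g h} → (∀ i → suc (suc m) ℕ.≤ i → g i ≈ h i) →
    iterate (Φ s) g m 2 ≈ iterate (Φ s) h m 2
  iterate-Φ-local s m {g} {h} g≈h = begin
    iterate (Φ s) g m 2         ≡⟨ sym (pairing≡iterate m g (suc (diag m)) ℕP.≤-refl) ⟩
    pairing m g (suc (diag m))  ≈⟨ sumBelow-cong-≈ (suc (diag m)) term ⟩
    pairing m h (suc (diag m))  ≡⟨ pairing≡iterate m h (suc (diag m)) ℕP.≤-refl ⟩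
    iterate (Φ s) h m 2         ∎
    where
    open RowSums s
    open import Relation.Binary.Reasoning.Setoid ≈-setoid
    term : ∀ i → i ℕ.< suc (diag m) → g i * R m i ≈ h i * R m i
    term i _ with i ℕ.<? suc (suc m)
    ... | yes i<m+2 = begin
            g i * R m i ≡⟨ cong (g i *_) (R-small m i i<m+2) ⟩
            g i * + 0   ≡⟨ ℤP.*-zeroʳ (g i) ⟩
            + 0         ≡⟨ sym (ℤP.*-zeroʳ (h i)) ⟩
            h i * + 0   ≡⟨ cong (h i *_) (sym (R-small m i i<m+2)) ⟩
            h i * R m i ∎
    ... | no  i≮m+2 = *-cong (g≈h i (ℕP.≮⇒≥ i≮m+2)) ≈-refl

  PeriodicFrom : ℕ → ℕ → (ℕ → ℤ) → Set
  PeriodicFrom N P g = ∀ i → N ℕ.≤ i → g (i ℕ.+ P) ≈ g i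

  Periodic : ℕ → (ℕ → ℤ) → Set
  Periodic = PeriodicFrom 0

  PeriodicFrom-*ˡ : ∀ {N P g} q → PeriodicFrom N P g → PeriodicFrom N (q ℕ.* P) g
  PeriodicFrom-*ˡ {g = g} zero    per i N≤i = ≈-reflexive (cong g (ℕP.+-identityʳ i))
  PeriodicFrom-*ˡ {N} {P} {g} (suc q) per i N≤i = begin
    g (i ℕ.+ (P ℕ.+ q ℕ.* P))  ≡⟨ cong g (regroup i P (q ℕ.* P)) ⟩
    g (i ℕ.+ q ℕ.* P ℕ.+ P)    ≈⟨ per (i ℕ.+ q ℕ.* P) (ℕP.≤-trans N≤i (ℕP.m≤m+n i _)) ⟩
    g (i ℕ.+ q ℕ.* P)          ≈⟨ PeriodicFrom-*ˡ q per i N≤i ⟩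
    g i                        ∎
    where
    open import Relation.Binary.Reasoning.Setoid ≈-setoid
    regroup : ∀ a b c → a ℕ.+ (b ℕ.+ c) ≡ a ℕ.+ c ℕ.+ b
    regroup a b c = trans (cong (a ℕ.+_) (ℕP.+-comm b c)) (sym (ℕP.+-assoc a c b))

  Periodic-mod : ∀ {M g} .{{_ : NonZero M}} → Periodic M g → ∀ i → g i ≈ g (i % M)
  Periodic-mod {M} {g} per i =
    ≈-trans (≈-reflexive (cong g (m≡m%n+[m/n]*n i M))) (PeriodicFrom-*ˡ (i / M) per (i % M) z≤n)

  Periodic-agree : ∀ {M g h} .{{_ : NonZero M}} → Periodic M g → Periodic M h →
    (∀ r → r ℕ.< M → g r ≈ h r) → g ≈ᶠ h
  Periodic-agree {M} per-g per-h g≈h i =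
    ≈-trans (Periodic-mod per-g i) (≈-trans (g≈h (i % M) (m%n<n i M)) (≈-sym (Periodic-mod per-h i)))

  PeriodicFrom⇒Periodic-tail : ∀ {N P g} .{{_ : NonZero P}} → PeriodicFrom N P g →
    Periodic P (λ i → g (i ℕ.+ N ℕ.* P))
  PeriodicFrom⇒Periodic-tail {N} {P} {g} per i _ = ≈-trans
    (≈-reflexive (cong g (regroup i P (N ℕ.* P))))
    (per (i ℕ.+ N ℕ.* P) (ℕP.≤-trans (ℕP.m≤m*n N P) (ℕP.m≤n+m (N ℕ.* P) i)))
    where
    regroup : ∀ a b c → a ℕ.+ b ℕ.+ c ≡ a ℕ.+ c ℕ.+ b
    regroup a b c = trans (ℕP.+-assoc a b c) (trans (cong (a ℕ.+_) (ℕP.+-comm b c)) (sym (ℕP.+-assoc a c b)))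

  Φ-periodic : ∀ s q {g} → Periodic (p ℕ.* q) g → Periodic (p ℕ.* q) (Φ s g)
  Φ-periodic s q {g} per i _ = +-cong
    (*-cong (+-cong i+pq-1≈i-1 (≈-refl {s})) (per (suc i) z≤n))
    (*-cong i+pq-1≈i-1 (per (suc (suc i)) z≤n))
    where
    i+pq-1≈i-1 : + (i ℕ.+ p ℕ.* q) - + 1 ≈ + i - + 1
    i+pq-1≈i-1 = +-cong (+-multiple i q) (≈-refl { - + 1 })

  reduce : .{{_ : NonZero p}} → ℤ → Fin p
  reduce a = fromℕ< (n%ℕd<d a p)

  reduce-injective : .{{_ : NonZero p}} → ∀ a b → reduce a ≡ reduce b → a ≈ b
  reduce-injective a b same = mk≈ (S.divides (a /ℕ p - b /ℕ p) (begin
    a - b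
      ≡⟨ cong₂ _-_ (a≡a%ℕn+[a/ℕn]*n a p) (a≡a%ℕn+[a/ℕn]*n b p) ⟩
    (+ (a %ℕ p) + a /ℕ p * + p) - (+ (b %ℕ p) + b /ℕ p * + p)
      ≡⟨ cong (λ r → (+ (a %ℕ p) + a /ℕ p * + p) - (+ r + b /ℕ p * + p)) (sym same-remainder) ⟩
    (+ (a %ℕ p) + a /ℕ p * + p) - (+ (a %ℕ p) + b /ℕ p * + p)
      ≡⟨ cancel (+ (a %ℕ p)) (a /ℕ p) (b /ℕ p) (+ p) ⟩
    (a /ℕ p - b /ℕ p) * + p ∎))
    where
    open ≡-Reasoning
    same-remainder : a %ℕ p ≡ b %ℕ p
    same-remainder = trans (sym (FP.toℕ-fromℕ< (n%ℕd<d a p)))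
                           (trans (cong toℕ same) (FP.toℕ-fromℕ< (n%ℕd<d b p)))
    cancel : ∀ r x y d → (r + x * d) - (r + y * d) ≡ (x - y) * d
    cancel = solve-∀

  periodic-pigeonhole : .{{_ : NonZero p}} → ∀ {M} .{{_ : NonZero M}} (F : ℕ → ℕ → ℤ) →
    (∀ k → Periodic M (F k)) → Σ ℕ λ k₁ → Σ ℕ λ k₂ → k₁ ℕ.< k₂ × F k₁ ≈ᶠ F k₂
  periodic-pigeonhole {M} F per =
    let x , y , x<y , same-code = FP.pigeonhole (ℕP.n<1+n (p ℕ.^ M)) code
    in toℕ x , toℕ y , x<y , Periodic-agree (per (toℕ x)) (per (toℕ y)) (agree-below x y same-code)
    where
    residues : ℕ → Fin M → Fin p
    residues k r = reduce (F k (toℕ r))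
    code : Fin (suc (p ℕ.^ M)) → Fin (p ℕ.^ M)
    code x = funToFin (residues (toℕ x))
    agree-below : ∀ x y → code x ≡ code y → ∀ r → r ℕ.< M → F (toℕ x) r ≈ F (toℕ y) r
    agree-below x y same-code r r<M = reduce-injective _ _ (begin
      reduce (F (toℕ x) r)
        ≡⟨ cong (reduce ∘ F (toℕ x)) (sym (FP.toℕ-fromℕ< r<M)) ⟩
      residues (toℕ x) (fromℕ< r<M)
        ≡⟨ sym (FP.finToFun-funToFin (residues (toℕ x)) (fromℕ< r<M)) ⟩
      finToFun {p} {M} (code x) (fromℕ< r<M)
        ≡⟨ cong (λ c → finToFun {p} {M} c (fromℕ< r<M)) same-code ⟩
      finToFun {p} {M} (code y) (fromℕ< r<M)
        ≡⟨ FP.finToFun-funToFin (residues (toℕ y)) (fromℕ< r<M) ⟩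
      residues (toℕ y) (fromℕ< r<M)
        ≡⟨ cong (reduce ∘ F (toℕ y)) (FP.toℕ-fromℕ< r<M) ⟩
      reduce (F (toℕ y) r) ∎)
      where open ≡-Reasoning

  eventuallyPeriodic⇒rational : p ≢ 1 → ∀ {N T f} → PeriodicFrom N (suc T) f → IsRationalModP p f
  eventuallyPeriodic⇒rational p≢1 {N} {T} {f} per =
    applyUpTo (mulCoeff Q f) L , Q , (0 , λ p∣1 → p≢1 (ND.∣1⇒≡1 p∣1)) , λ n → ≈⇒≡[mod] (Q*f≈P n)
    where
    Q = one-minus-x^suc T
    L = N ℕ.+ suc T
    Q*f≈P : ∀ n → mulCoeff Q f n ≈ coeff (applyUpTo (mulCoeff Q f) L) n
    Q*f≈P n with n ℕ.<? L
    ... | yes n<L = ≈-reflexive (sym (coeff-applyUpTo-< (mulCoeff Q f) n<L))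
    ... | no  n≮L = begin
      mulCoeff Q f n                        ≡⟨ mulCoeff-one-minus-x^suc T f n 1+T≤n ⟩
      f n - f m                             ≡⟨ cong (λ k → f k - f m) (sym (ℕP.m∸n+n≡m 1+T≤n)) ⟩
      f (m ℕ.+ suc T) - f m                 ≈⟨ +-cong (per m N≤m) (≈-refl { - f m }) ⟩
      f m - f m                             ≡⟨ ℤP.+-inverseʳ (f m) ⟩
      + 0                                   ≡⟨ sym (coeff-applyUpTo-≥ (mulCoeff Q f) L≤n) ⟩
      coeff (applyUpTo (mulCoeff Q f) L) n  ∎
      where
      open import Relation.Binary.Reasoning.Setoid ≈-setoid
      L≤n = ℕP.≮⇒≥ n≮L
      1+T≤n = ℕP.≤-trans (ℕP.m≤n+m (suc T) N) L≤n
      m = n ∸ suc T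
      N≤m : N ℕ.≤ m
      N≤m = subst (ℕ._≤ m) (ℕP.m+n∸n≡m N (suc T)) (ℕP.∸-monoˡ-≤ (suc T) L≤n)

  Ucoeff-eventuallyPeriodic : .{{_ : NonZero p}} → ∀ {σ N P} .{{_ : NonZero P}} →
    PeriodicFrom N P σ → Σ ℕ λ K → Σ ℕ λ T → PeriodicFrom K (suc T) (Ucoeff σ)
  Ucoeff-eventuallyPeriodic {σ} {N} {P} per =
    let k₁ , k₂ , k₁<k₂ , loop = periodic-pigeonhole orbit orbit-periodic
        T = k₂ ∸ suc k₁
    in suc (N ℕ.+ k₁) , T , λ where
      (suc m) (s≤s N+k₁≤m) → begin
        Ucoeff σ (suc (m ℕ.+ suc T))
          ≈⟨ Ucoeff≈orbit _ (ℕP.≤-trans (ℕP.m≤m+n N k₁) (ℕP.≤-trans N+k₁≤m (ℕP.m≤m+n m _))) ⟩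
        - orbit (m ℕ.+ suc T) 2
          ≡⟨ cong (λ T → - orbit (m ℕ.+ T) 2) (sym (ℕP.+-∸-assoc 1 k₁<k₂)) ⟩
        - orbit (m ℕ.+ (k₂ ∸ k₁)) 2
          ≈⟨ neg-cong (iterate-eventually-periodic {_~_ = _≈ᶠ_} (Φ s) (Φ-cong s) (ℕP.<⇒≤ k₁<k₂)
                         (λ i → ≈-sym (loop i)) m (ℕP.≤-trans (ℕP.m≤n+m k₁ N) N+k₁≤m) 2) ⟩
        - orbit m 2
          ≈⟨ ≈-sym (Ucoeff≈orbit m (ℕP.≤-trans (ℕP.m≤m+n N k₁) N+k₁≤m)) ⟩
        Ucoeff σ (suc m) ∎
    where
    open import Relation.Binary.Reasoning.Setoid ≈-setoid
    M = p ℕ.* P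
    instance
      M≢0 : NonZero M
      M≢0 = ℕP.m*n≢0 p P
    s = - σ 1
    perM : PeriodicFrom N M σ
    perM = PeriodicFrom-*ˡ p per
    -- σ̃ is periodic and equals σ from N on.  Its period is a multiple of p because
    -- the coefficients of Φ are only periodic modulo p.
    σ̃ : ℕ → ℤ
    σ̃ i = σ (i ℕ.+ N ℕ.* M)
    orbit : ℕ → ℕ → ℤ
    orbit = iterate (Φ s) σ̃
    orbit-periodic : ∀ k → Periodic M (orbit k)
    orbit-periodic k =
      iterate-preserves {P = Periodic M} (Φ s) (Φ-periodic s P) k (PeriodicFrom⇒Periodic-tail perM)
    Ucoeff≈orbit : ∀ m → N ℕ.≤ m → Ucoeff σ (suc m) ≈ - orbit m 2
    Ucoeff≈orbit m N≤m = ≈-trans (≈-reflexive (Ucoeff-suc σ m)) (neg-cong (iterate-Φ-local s m σ≈σ̃))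
      where
      σ≈σ̃ : ∀ i → suc (suc m) ℕ.≤ i → σ i ≈ σ̃ i
      σ≈σ̃ i m+2≤i = ≈-sym (PeriodicFrom-*ˡ N perM i (ℕP.≤-trans N≤m (ℕP.≤-trans (ℕP.n≤1+n m) (ℕP.<⇒≤ m+2≤i))))

proposition10p1 : (p : ℕ) → Prime p → (σ : ℕ → ℤ) → UltPeriodicMod p σ →
    IsRationalModP p (Ucoeff σ)
proposition10p1 p p-prime σ (N , P , P>0 , per) =
  let _ , _ , Ucoeff-periodic = Ucoeff-eventuallyPeriodic {{prime⇒nonZero p-prime}} {{ℕ.>-nonZero P>0}}
                                  (λ i N≤i → ≡[mod]⇒≈ (per i N≤i))
  in eventuallyPeriodic⇒rational (ℕ.nonTrivial⇒≢1 {{prime⇒nonTrivial p-prime}}) Ucoeff-periodic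
  where open Modular p
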